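{- Let $S=\{i_1,i_2,\dots,i_s\}$ be admissible. Then $\#\widehat{P}(S,n)$ is even if and only if there exists $i_j\in S$ such that $i_j$ is even.
   Context: $S_n$ is the set of permutations $\pi=\pi_1\cdots\pi_n$ of $\{1,\dots,n\}$. Set $\pi_0=0$. An index $i\in\{1,\dots,n-1\}$ is a peak of $\pi$ if $\pi_{i-1}<\pi_i>\pi_{i+1}$. $\widehat{P}(S,n)$ is the set of $\pi\in S_n$ whose peak set (in this sense) equals $S$. $S$ is $n$-admissible if $\widehat{P}(S,n)\ne\emptyset$; "admissible" means the statement is asserted for every $n$ for which $S$ is $n$-admissible. -}

module Defs where

open import Data.Nat using (ℕ; zero; suc; _<_; _≤_)
open import Data.List using (List; []; _∷_; map; upTo; lookup; length)
open import Data.Product using (_×_)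
open import Data.List.Membership.Propositional using (_∈_)
open import Data.List.Relation.Binary.Permutation.Propositional using (_↭_)
open import Function.Bundles using (_⇔_)

oneTo : ℕ → List ℕ
oneTo n = map suc (upTo n)

IsPerm : ℕ → List ℕ → Set
IsPerm n π = π ↭ oneTo n

at : List ℕ → ℕ → ℕ
at []       _       = 0
at (x ∷ xs) zero    = x
at (x ∷ xs) (suc k) = at xs k

-- one-based value π_i, with the convention π_0 = 0
val : List ℕ → ℕ → ℕ
val π zero    = 0
val π (suc i) = at π i

IsPeak : ℕ → List ℕ → ℕ → Set
IsPeak n π zero    = 0 < 0   -- index 0 is never a peak (i ≥ 1 required)
IsPeak n π (suc k) = suc k < n × val π k < val π (suc k) × val π (suc (suc k)) < val π (suc k)

InPhat : List ℕ → ℕ → List ℕ → Set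
InPhat S n π = IsPerm n π × (∀ i → (i ∈ S) ⇔ IsPeak n π i)

-- Group 1, …, n into blocks {2t-1, 2t}. Exchanging the two values of a block in π
-- can change the peak set only when they are adjacent in π with a smaller
-- neighbour; exchanging the largest block where this does not happen is an
-- involution on P̂(S,n), so #P̂(S,n) has the parity of its number of fixed points.
-- A fixed point maps every block of positions onto the same block of values, so
-- its peaks are odd and it is determined by its peak set; when S is odd, the
-- permutation exchanging exactly the blocks that start at an element of S is one.
-- Hence there is no fixed point if S has an even element, and exactly one otherwise.

module Submission where

open import Defs
open import Data.Bool using (if_then_else_)
open import Data.List using (List; []; _∷_; map; length; upTo; applyUpTo; filter)
open import Data.List.Membership.Propositional using (_∈_; find; lose)
open import Data.List.Membership.Propositional.Properties
  using (∈-map⁺; ∈-map⁻; ∈-upTo⁺; ∈-upTo⁻; ∈-filter⁺; ∈-filter⁻)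
open import Data.List.Membership.Propositional.Properties.WithK using (unique∧set⇒bag)
open import Data.List.Properties
  using (length-map; length-upTo; map-upTo; map-∘; map-cong; map-id; ∷-injective;
         filter-reject; filter-all; filter-none; ≡-dec)
open import Data.List.Relation.Binary.BagAndSetEquality using (∼bag⇒↭)
open import Data.List.Relation.Binary.Permutation.Propositional using (↭-refl; ↭-sym; ↭⇒↭ₛ)
open import Data.List.Relation.Binary.Permutation.Propositional.Properties using (∈-resp-↭; ↭-length)
open import Data.List.Relation.Binary.Permutation.Setoid.Properties using (Unique-resp-↭)
open import Data.List.Relation.Unary.All as All using ()
open import Data.List.Relation.Unary.AllPairs using (_∷_)
open import Data.List.Relation.Unary.Any using (Any; here; there; any?)
open import Data.List.Relation.Unary.Unique.Propositional using (Unique)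
import Data.List.Relation.Unary.Unique.Propositional.Properties as Unique
open import Data.Maybe using (Maybe; just; nothing)
open import Data.Nat
open import Data.Nat.Divisibility
  using (_∣_; _∤_; divides; _∣?_; ∣-refl; ∣m∣n⇒∣m+n; ∣m+n∣m⇒∣n; m∣m*n; ∣1⇒≡1; _∣0)
open import Data.Nat.Properties
open import Data.Product using (Σ; ∃; ∃-syntax; _×_; _,_; proj₁; proj₂)
open import Data.Product.Function.NonDependent.Propositional using (_×-⇔_)
open import Data.Sum using (_⊎_; inj₁; inj₂; [_,_]′; map₂)
open import Function.Base using (id; _∘_)
open import Function.Bundles using (_⇔_; mk⇔; Equivalence)
import Function.Properties.Equivalence as ⇔
open import Relation.Binary.Definitions using (DecidableEquality)
open import Relation.Binary.PropositionalEquality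
open import Relation.Nullary using (Dec; yes; no; does; ¬_; contradiction)
open import Relation.Nullary.Decidable using (_×-dec_; _⊎-dec_; ¬?; _→-dec_; map′)
open import Relation.Unary using (Decidable)

-- The blocks are the fibres {2t-1, 2t} of ⌈_/2⌉ and partner exchanges the two
-- elements of each block; "i is odd" is expressed as ⌈ suc i /2⌉ ≡ ⌈ i /2⌉.
partner : ℕ → ℕ
partner 0                   = 0
partner 1                   = 2
partner 2                   = 1
partner (suc (suc (suc x))) = suc (suc (partner (suc x)))

⌈partner/2⌉ : ∀ x → ⌈ partner x /2⌉ ≡ ⌈ x /2⌉
⌈partner/2⌉ 0                   = refl
⌈partner/2⌉ 1                   = refl
⌈partner/2⌉ 2                   = refl
⌈partner/2⌉ (suc (suc (suc x))) = cong suc (⌈partner/2⌉ (suc x))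

1≤partner : ∀ {x} → 1 ≤ x → 1 ≤ partner x
1≤partner {1}                 _ = s≤s z≤n
1≤partner {2}                 _ = s≤s z≤n
1≤partner {suc (suc (suc x))} _ = s≤s z≤n

partner-2+ : ∀ {x} → 1 ≤ x → partner (2 + x) ≡ 2 + partner x
partner-2+ {suc x} _ = refl

partner-involutive : ∀ x → partner (partner x) ≡ x
partner-involutive 0                   = refl
partner-involutive 1                   = refl
partner-involutive 2                   = refl
partner-involutive (suc (suc (suc x))) = begin
  partner (2 + partner (suc x))   ≡⟨ partner-2+ (1≤partner (s≤s z≤n)) ⟩
  2 + partner (partner (suc x))   ≡⟨ cong (2 +_) (partner-involutive (suc x)) ⟩
  suc (suc (suc x))               ∎
  where open ≡-Reasoning

partner≢ : ∀ {x} → 1 ≤ x → partner x ≢ x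
partner≢ {suc (suc (suc x))} _ eq = partner≢ {suc x} (s≤s z≤n) (suc-injective (suc-injective eq))

partner≤2*⌈n/2⌉ : ∀ x → partner x ≤ 2 * ⌈ x /2⌉
partner≤2*⌈n/2⌉ 0                   = z≤n
partner≤2*⌈n/2⌉ 1                   = ≤-refl
partner≤2*⌈n/2⌉ 2                   = s≤s z≤n
partner≤2*⌈n/2⌉ (suc (suc (suc x))) = begin
  2 + partner (suc x)          ≤⟨ s≤s (s≤s (partner≤2*⌈n/2⌉ (suc x))) ⟩
  2 + 2 * ⌈ suc x /2⌉          ≡⟨ sym (*-suc 2 ⌈ suc x /2⌉) ⟩
  2 * ⌈ suc (suc (suc x)) /2⌉  ∎
  where open ≤-Reasoning

same-block : ∀ x y → ⌈ y /2⌉ ≡ ⌈ x /2⌉ → y ≡ x ⊎ y ≡ partner x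
same-block 0 0 _ = inj₁ refl
same-block 1 1 _ = inj₁ refl
same-block 1 2 _ = inj₂ refl
same-block 2 1 _ = inj₂ refl
same-block 2 2 _ = inj₁ refl
same-block (suc (suc (suc x))) (suc (suc (suc y))) eq
  with same-block (suc x) (suc y) (suc-injective eq)
... | inj₁ y≡x = inj₁ (cong (2 +_) y≡x)
... | inj₂ y≡x′ = inj₂ (cong (2 +_) y≡x′)
same-block 0 (suc (suc y)) ()
same-block 1 (suc (suc (suc y))) ()
same-block 2 (suc (suc (suc y))) ()
same-block (suc (suc (suc x))) 1 ()
same-block (suc (suc (suc x))) 2 ()

other-of-block : ∀ {x y} → ⌈ y /2⌉ ≡ ⌈ x /2⌉ → y ≢ x → y ≡ partner x
other-of-block {x} {y} eq y≢x with same-block x y eq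
... | inj₁ y≡x  = contradiction y≡x y≢x
... | inj₂ y≡x′ = y≡x′

odd⇒partner≡suc : ∀ {i} → ⌈ suc i /2⌉ ≡ ⌈ i /2⌉ → partner i ≡ suc i
odd⇒partner≡suc eq = sym (other-of-block eq 1+n≢n)

block-pair : ∀ {x y z} → ⌈ y /2⌉ ≡ ⌈ x /2⌉ → y ≢ x → ⌈ z /2⌉ ≡ ⌈ x /2⌉ → z ≡ x ⊎ z ≡ y
block-pair {x} {y} {z} y∼x y≢x z∼x with same-block x z z∼x
... | inj₁ z≡x  = inj₁ z≡x
... | inj₂ z≡x′ = inj₂ (trans z≡x′ (sym (other-of-block y∼x y≢x)))

ordered-block : ∀ {a x y} → ⌈ suc a /2⌉ ≡ ⌈ a /2⌉ → ⌈ x /2⌉ ≡ ⌈ a /2⌉ → ⌈ y /2⌉ ≡ ⌈ a /2⌉ → x ≢ y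
              → (y < x → x ≡ suc a) × (¬ y < x → x ≡ a)
ordered-block {a} {x} {y} a-odd x∼a y∼a x≢y
  with block-pair a-odd (1+n≢n) x∼a | block-pair a-odd (1+n≢n) y∼a
... | inj₁ refl | inj₁ refl = contradiction refl x≢y
... | inj₁ refl | inj₂ refl = (λ y<x → contradiction y<x (<-asym (n<1+n a))) , λ _ → refl
... | inj₂ refl | inj₁ refl = (λ _ → refl) , λ y≮x → contradiction (n<1+n a) y≮x
... | inj₂ refl | inj₂ refl = contradiction refl x≢y

odd-same-block : ∀ {a b} → ⌈ suc a /2⌉ ≡ ⌈ a /2⌉ → ⌈ suc b /2⌉ ≡ ⌈ b /2⌉ → ⌈ b /2⌉ ≡ ⌈ a /2⌉ → b ≡ a
odd-same-block {a} {b} a-odd b-odd b∼a with same-block a b b∼a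
... | inj₁ b≡a  = b≡a
... | inj₂ b≡a′ = contradiction
  (trans (cong (λ x → ⌈ suc x /2⌉) (sym b≡sa)) (trans b-odd (trans (cong ⌈_/2⌉ b≡sa) a-odd))) 1+n≢n
  where b≡sa = trans b≡a′ (odd⇒partner≡suc a-odd)

block-start : ∀ q → ∃[ k ] ⌈ 2 + k /2⌉ ≡ ⌈ suc k /2⌉ × (suc q ≡ suc k ⊎ suc q ≡ 2 + k)
block-start 0             = 0 , refl , inj₁ refl
block-start 1             = 0 , refl , inj₂ refl
block-start (suc (suc q)) with block-start q
... | k , odd , inj₁ eq = 2 + k , cong suc odd , inj₁ (cong (2 +_) eq)
... | k , odd , inj₂ eq = 2 + k , cong suc odd , inj₂ (cong (2 +_) eq)

⌈n/2⌉-cancel-< : ∀ {x y} → ⌈ x /2⌉ < ⌈ y /2⌉ → x < y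
⌈n/2⌉-cancel-< {x} {y} lt with x <? y
... | yes x<y = x<y
... | no  x≮y = contradiction (⌈n/2⌉-mono (≮⇒≥ x≮y)) (<⇒≱ lt)

⌈2*n/2⌉≡n : ∀ n → ⌈ 2 * n /2⌉ ≡ n
⌈2*n/2⌉≡n n = trans (cong (λ m → ⌈ n + m /2⌉) (+-identityʳ n)) (sym (n≡⌈n+n/2⌉ n))

⌊2*n/2⌋≡n : ∀ n → ⌊ 2 * n /2⌋ ≡ n
⌊2*n/2⌋≡n n = trans (cong (λ m → ⌊ n + m /2⌋) (+-identityʳ n)) (sym (n≡⌊n+n/2⌋ n))

lower-block-≮ : ∀ {x y} → ⌈ x /2⌉ < ⌈ y /2⌉ → ¬ y < x
lower-block-≮ lt y<x = <-asym y<x (⌈n/2⌉-cancel-< lt)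

2∤n⇔⌈1+n/2⌉≡⌈n/2⌉ : ∀ n → 2 ∤ n ⇔ ⌈ suc n /2⌉ ≡ ⌈ n /2⌉
2∤n⇔⌈1+n/2⌉≡⌈n/2⌉ n = mk⇔ (to n) (λ eq 2∣n → from 2∣n eq)
  where
  to : ∀ n → 2 ∤ n → ⌈ suc n /2⌉ ≡ ⌈ n /2⌉
  to 0             2∤0 = contradiction (2 ∣0) 2∤0
  to 1             _   = refl
  to (suc (suc n)) 2∤n = cong suc (to n (λ 2∣n → 2∤n (∣m∣n⇒∣m+n ∣-refl 2∣n)))
  from : ∀ {n} → 2 ∣ n → ⌈ suc n /2⌉ ≢ ⌈ n /2⌉
  from (divides (suc q) refl) eq = from (divides q refl) (suc-injective eq)

2∤1+2*n : ∀ n → 2 ∤ 1 + 2 * n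
2∤1+2*n t 2∣ = contradiction (∣1⇒≡1 (∣m+n∣m⇒∣n (subst (2 ∣_) (+-comm 1 (2 * t)) 2∣) (m∣m*n t))) λ ()

swapBlocks : {P : ℕ → Set} → Decidable P → ℕ → ℕ
swapBlocks P? x = if does (P? ⌈ x /2⌉) then partner x else x

module _ {P : ℕ → Set} (P? : Decidable P) where

  swapBlocks-swap : ∀ {x} → P ⌈ x /2⌉ → swapBlocks P? x ≡ partner x
  swapBlocks-swap {x} p with P? ⌈ x /2⌉
  ... | yes _ = refl
  ... | no ¬p = contradiction p ¬p

  swapBlocks-keep : ∀ {x} → ¬ P ⌈ x /2⌉ → swapBlocks P? x ≡ x
  swapBlocks-keep {x} ¬p with P? ⌈ x /2⌉
  ... | yes p = contradiction p ¬p
  ... | no _  = refl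

  ⌈swapBlocks/2⌉ : ∀ x → ⌈ swapBlocks P? x /2⌉ ≡ ⌈ x /2⌉
  ⌈swapBlocks/2⌉ x with P? ⌈ x /2⌉
  ... | yes _ = ⌈partner/2⌉ x
  ... | no _  = refl

  swapBlocks-0 : swapBlocks P? 0 ≡ 0
  swapBlocks-0 with P? 0
  ... | yes _ = refl
  ... | no _  = refl

  swapBlocks-involutive : ∀ x → swapBlocks P? (swapBlocks P? x) ≡ x
  swapBlocks-involutive x with P? ⌈ x /2⌉
  ... | yes p = trans (swapBlocks-swap (subst P (sym (⌈partner/2⌉ x)) p)) (partner-involutive x)
  ... | no ¬p = swapBlocks-keep ¬p

  swapBlocks-injective : ∀ {x y} → swapBlocks P? x ≡ swapBlocks P? y → x ≡ y
  swapBlocks-injective {x} {y} eq = begin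
    x                                    ≡⟨ sym (swapBlocks-involutive x) ⟩
    swapBlocks P? (swapBlocks P? x)      ≡⟨ cong (swapBlocks P?) eq ⟩
    swapBlocks P? (swapBlocks P? y)      ≡⟨ swapBlocks-involutive y ⟩
    y                                    ∎
    where open ≡-Reasoning

  swapBlocks-preserves-< : ∀ {x y} → (x ≢ y → ⌈ x /2⌉ ≡ ⌈ y /2⌉ → ¬ P ⌈ x /2⌉)
                         → x < y ⇔ swapBlocks P? x < swapBlocks P? y
  swapBlocks-preserves-< {x} {y} unswapped with x ≟ y | ⌈ x /2⌉ ≟ ⌈ y /2⌉
  ... | yes refl | _ = mk⇔ (λ x<x → contradiction x<x (n≮n x)) (λ x<x → contradiction x<x (n≮n _))
  ... | no x≢y | yes same
    rewrite swapBlocks-keep (unswapped x≢y same)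
          | swapBlocks-keep (subst (¬_ ∘ P) same (unswapped x≢y same)) = mk⇔ id id
  ... | no _ | no apart = mk⇔
    (λ x<y → ⌈n/2⌉-cancel-< (subst₂ _<_ (sym (⌈swapBlocks/2⌉ x)) (sym (⌈swapBlocks/2⌉ y)) (across apart x<y)))
    (λ sx<sy → ⌈n/2⌉-cancel-< (subst₂ _<_ (⌈swapBlocks/2⌉ x) (⌈swapBlocks/2⌉ y) (across apart′ sx<sy)))
    where
    across : ∀ {a b} → ⌈ a /2⌉ ≢ ⌈ b /2⌉ → a < b → ⌈ a /2⌉ < ⌈ b /2⌉
    across apart a<b = ≤∧≢⇒< (⌈n/2⌉-mono (<⇒≤ a<b)) apart
    apart′ : ⌈ swapBlocks P? x /2⌉ ≢ ⌈ swapBlocks P? y /2⌉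
    apart′ eq = apart (trans (sym (⌈swapBlocks/2⌉ x)) (trans eq (⌈swapBlocks/2⌉ y)))

swapBlocks-range : ∀ {P : ℕ → Set} (P? : Decidable P) {n} → (∀ {x} → P ⌈ x /2⌉ → x ≤ n → partner x ≤ n)
                 → ∀ {x} → 1 ≤ x → x ≤ n → 1 ≤ swapBlocks P? x × swapBlocks P? x ≤ n
swapBlocks-range P? bounded {x} 1≤x x≤n with P? ⌈ x /2⌉
... | yes p = 1≤partner 1≤x , bounded p x≤n
... | no _  = 1≤x , x≤n

at-map : ∀ (g : ℕ → ℕ) xs i → g 0 ≡ 0 → at (map g xs) i ≡ g (at xs i)
at-map g []       i       g0≡0 = sym g0≡0
at-map g (x ∷ xs) zero    _    = refl
at-map g (x ∷ xs) (suc i) g0≡0 = at-map g xs i g0≡0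

val-map : ∀ (g : ℕ → ℕ) xs q → g 0 ≡ 0 → val (map g xs) q ≡ g (val xs q)
val-map g xs zero    g0≡0 = sym g0≡0
val-map g xs (suc q) g0≡0 = at-map g xs q g0≡0

val-swapBlocks : ∀ {P : ℕ → Set} (P? : Decidable P) π q → val (map (swapBlocks P?) π) q ≡ swapBlocks P? (val π q)
val-swapBlocks P? π q = val-map (swapBlocks P?) π q (swapBlocks-0 P?)

⌈val-swapBlocks/2⌉ : ∀ {P : ℕ → Set} (P? : Decidable P) π q → ⌈ val (map (swapBlocks P?) π) q /2⌉ ≡ ⌈ val π q /2⌉
⌈val-swapBlocks/2⌉ P? π q = trans (cong ⌈_/2⌉ (val-swapBlocks P? π q)) (⌈swapBlocks/2⌉ P? (val π q))

at-∈ : ∀ xs {i} → i < length xs → at xs i ∈ xs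
at-∈ (x ∷ xs) {zero}  _         = here refl
at-∈ (x ∷ xs) {suc i} (s≤s i<) = there (at-∈ xs i<)

at-beyond : ∀ xs {i} → length xs ≤ i → at xs i ≡ 0
at-beyond []       _         = refl
at-beyond (x ∷ xs) {suc i} (s≤s le) = at-beyond xs le

at-injective : ∀ {xs i j} → Unique xs → i < length xs → j < length xs → at xs i ≡ at xs j → i ≡ j
at-injective {x ∷ xs} {zero}  {zero}  _        _        _        _  = refl
at-injective {x ∷ xs} {zero}  {suc j} (x∉ ∷ _) _        (s≤s j<) eq = contradiction eq (All.lookup x∉ (at-∈ xs j<))
at-injective {x ∷ xs} {suc i} {zero}  (x∉ ∷ _) (s≤s i<) _        eq = contradiction (sym eq) (All.lookup x∉ (at-∈ xs i<))
at-injective {x ∷ xs} {suc i} {suc j} (_ ∷ u)  (s≤s i<) (s≤s j<) eq = cong suc (at-injective u i< j< eq)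

at-ext : ∀ {xs ys} → length xs ≡ length ys → (∀ i → at xs i ≡ at ys i) → xs ≡ ys
at-ext {[]}     {[]}     _   _  = refl
at-ext {x ∷ xs} {y ∷ ys} len eq = cong₂ _∷_ (eq 0) (at-ext (suc-injective len) (eq ∘ suc))

at-applyUpTo : ∀ (f : ℕ → ℕ) {n i} → i < n → at (applyUpTo f n) i ≡ f i
at-applyUpTo f {suc n} {zero}  _        = refl
at-applyUpTo f {suc n} {suc i} (s≤s i<) = at-applyUpTo (f ∘ suc) i<

val-oneTo : ∀ {n q} → q ≤ n → val (oneTo n) q ≡ q
val-oneTo {n} {zero}  _  = refl
val-oneTo {n} {suc q} le = trans (cong (λ xs → at xs q) (map-upTo suc n)) (at-applyUpTo suc le)

length-oneTo : ∀ n → length (oneTo n) ≡ n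
length-oneTo n = trans (length-map suc (upTo n)) (length-upTo n)

∈-oneTo⁻ : ∀ {n x} → x ∈ oneTo n → 1 ≤ x × x ≤ n
∈-oneTo⁻ x∈ with ∈-map⁻ suc x∈
... | y , y∈ , refl = s≤s z≤n , ∈-upTo⁻ y∈

∈-oneTo⁺ : ∀ {n x} → 1 ≤ x → x ≤ n → x ∈ oneTo n
∈-oneTo⁺ {x = suc y} _ le = ∈-map⁺ suc (∈-upTo⁺ le)

oneTo-unique : ∀ n → Unique (oneTo n)
oneTo-unique n = Unique.map⁺ suc-injective (Unique.upTo⁺ n)

module _ {n π} (perm : IsPerm n π) where

  perm-length : length π ≡ n
  perm-length = trans (↭-length perm) (length-oneTo n)

  perm-unique : Unique π
  perm-unique = Unique-resp-↭ (setoid ℕ) (↭⇒↭ₛ (↭-sym perm)) (oneTo-unique n)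

  perm-∈⁻ : ∀ {x} → x ∈ π → 1 ≤ x × x ≤ n
  perm-∈⁻ x∈ = ∈-oneTo⁻ (∈-resp-↭ perm x∈)

  perm-∈⁺ : ∀ {x} → 1 ≤ x → x ≤ n → x ∈ π
  perm-∈⁺ 1≤x x≤n = ∈-resp-↭ (↭-sym perm) (∈-oneTo⁺ 1≤x x≤n)

  perm-val-range : ∀ {q} → 1 ≤ q → q ≤ n → 1 ≤ val π q × val π q ≤ n
  perm-val-range {suc q} _ q< = perm-∈⁻ (at-∈ π (subst (q <_) (sym perm-length) q<))

  perm-val-beyond : ∀ {q} → n < q → val π q ≡ 0
  perm-val-beyond {suc q} (s≤s n≤q) = at-beyond π (subst (_≤ q) (sym perm-length) n≤q)

  -- position 0 carries the value 0, so injectivity holds on all of [0, n]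
  perm-val-injective : ∀ {q r} → q ≤ n → r ≤ n → val π q ≡ val π r → q ≡ r
  perm-val-injective {zero}  {zero}  _  _  _  = refl
  perm-val-injective {zero}  {suc r} _  r≤ eq = contradiction (sym eq) (m<n⇒n≢0 (proj₁ (perm-val-range (s≤s z≤n) r≤)))
  perm-val-injective {suc q} {zero}  q≤ _  eq = contradiction eq (m<n⇒n≢0 (proj₁ (perm-val-range (s≤s z≤n) q≤)))
  perm-val-injective {suc q} {suc r} q≤ r≤ eq =
    cong suc (at-injective perm-unique (subst (q <_) (sym perm-length) q≤) (subst (r <_) (sym perm-length) r≤) eq)

map-involution-perm : ∀ {n π} (g : ℕ → ℕ) → (∀ x → g (g x) ≡ x)
                    → (∀ {x} → 1 ≤ x → x ≤ n → 1 ≤ g x × g x ≤ n) → IsPerm n π → IsPerm n (map g π)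
map-involution-perm {n} {π} g involutive range perm =
  ∼bag⇒↭ (unique∧set⇒bag (Unique.map⁺ g-injective (perm-unique perm)) (oneTo-unique n) (mk⇔ to from))
  where
  g-injective : ∀ {x y} → g x ≡ g y → x ≡ y
  g-injective {x} {y} eq = trans (sym (involutive x)) (trans (cong g eq) (involutive y))
  to : ∀ {x} → x ∈ map g π → x ∈ oneTo n
  to x∈ with ∈-map⁻ g x∈
  ... | y , y∈ , refl = let (1≤y , y≤n) = perm-∈⁻ perm y∈ in
    ∈-oneTo⁺ (proj₁ (range 1≤y y≤n)) (proj₂ (range 1≤y y≤n))
  from : ∀ {x} → x ∈ oneTo n → x ∈ map g π
  from {x} x∈ with ∈-oneTo⁻ x∈
  ... | 1≤x , x≤n =
    subst (_∈ map g π) (involutive x) (∈-map⁺ g (perm-∈⁺ perm (proj₁ (range 1≤x x≤n)) (proj₂ (range 1≤x x≤n))))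

map-involutive : ∀ {A : Set} {g : A → A} → (∀ x → g (g x) ≡ x) → ∀ xs → map g (map g xs) ≡ xs
map-involutive {g} involutive xs = trans (sym (map-∘ xs)) (trans (map-cong involutive xs) (map-id xs))

map-fixed : ∀ {A : Set} {g : A → A} {xs x} → map g xs ≡ xs → x ∈ xs → g x ≡ x
map-fixed {xs = _ ∷ _} eq (here refl) = proj₁ (∷-injective eq)
map-fixed {xs = _ ∷ _} eq (there x∈)  = map-fixed (proj₂ (∷-injective eq)) x∈

module _ {A : Set} (_≟ᴬ_ : DecidableEquality A) where

  remove : A → List A → List A
  remove z = filter (λ y → ¬? (y ≟ᴬ z))

  length-remove : ∀ {z xs} → Unique xs → z ∈ xs → length xs ≡ suc (length (remove z xs))
  length-remove {z} {y ∷ xs} (y∉ ∷ _) (here refl) = cong suc (begin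
    length xs                  ≡⟨ cong length (sym (filter-all (λ y → ¬? (y ≟ᴬ z)) (All.map (_∘ sym) y∉))) ⟩
    length (remove z xs)       ≡⟨ cong length (sym (filter-reject (λ y → ¬? (y ≟ᴬ z)) (λ z≢z → z≢z refl))) ⟩
    length (remove z (z ∷ xs)) ∎)
    where open ≡-Reasoning
  length-remove {z} {y ∷ xs} (y∉ ∷ u) (there z∈) with y ≟ᴬ z
  ... | yes refl = contradiction refl (All.lookup y∉ z∈)
  ... | no  _    = cong suc (length-remove u z∈)

  filter-remove : ∀ {P : A → Set} (P? : Decidable P) {z} → ¬ P z → ∀ xs → filter P? (remove z xs) ≡ filter P? xs
  filter-remove P? ¬Pz []       = refl
  filter-remove P? {z} ¬Pz (x ∷ xs) with x ≟ᴬ z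
  ... | yes refl = trans (filter-remove P? ¬Pz xs) (sym (filter-reject P? ¬Pz))
  ... | no  _ with P? x
  ...   | yes _ = cong (x ∷_) (filter-remove P? ¬Pz xs)
  ...   | no  _ = filter-remove P? ¬Pz xs

  length≡1 : ∀ {xs : List A} {x} → Unique xs → x ∈ xs → (∀ {y} → y ∈ xs → y ≡ x) → length xs ≡ 1
  length≡1 {_ ∷ []}     _          _ _    = refl
  length≡1 {_ ∷ _ ∷ _} (y∉ ∷ _) _ only =
    contradiction (trans (only (here refl)) (sym (only (there (here refl))))) (All.lookup y∉ (here refl))

  Fixed? : (f : A → A) → Decidable (λ x → f x ≡ x)
  Fixed? f x = f x ≟ᴬ x

  module _ (f : A → A) (involutive : ∀ x → f (f x) ≡ x) where

    involution-parity : ∀ {xs} → Unique xs → (∀ {x} → x ∈ xs → f x ∈ xs)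
                      → ∃[ t ] length xs ≡ length (filter (Fixed? f) xs) + 2 * t
    involution-parity {xs} = go (length xs) ≤-refl
      where
      go : ∀ N {xs} → length xs ≤ N → Unique xs → (∀ {x} → x ∈ xs → f x ∈ xs)
         → ∃[ t ] length xs ≡ length (filter (Fixed? f) xs) + 2 * t
      go _       {[]}     _         _          _      = 0 , refl
      go (suc N) {x ∷ xs} (s≤s len) (x∉ ∷ u) closed with Fixed? f x
      ... | yes fx≡x = let (t , eq) = go N len u closed′ in t , cong suc eq
        where
        closed′ : ∀ {y} → y ∈ xs → f y ∈ xs
        closed′ {y} y∈ with closed (there y∈)
        ... | here fy≡x = contradiction (trans (sym (involutive y)) (trans (cong f fy≡x) fx≡x)) (All.lookup x∉ y∈ ∘ sym)
        ... | there fy∈ = fy∈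
      ... | no fx≢x = suc t , (begin
          suc (length xs)                                   ≡⟨ cong suc (length-remove u fx∈) ⟩
          2 + length ys                                     ≡⟨ cong (2 +_) eq ⟩
          2 + (length (filter (Fixed? f) ys) + 2 * t)
            ≡⟨ cong (λ zs → 2 + (length zs + 2 * t)) (filter-remove (Fixed? f) fx-unfixed xs) ⟩
          2 + (length (filter (Fixed? f) xs) + 2 * t)            ≡⟨ cong suc (sym (+-suc _ (2 * t))) ⟩
          suc (length (filter (Fixed? f) xs) + suc (2 * t))      ≡⟨ sym (+-suc _ (suc (2 * t))) ⟩
          length (filter (Fixed? f) xs) + (2 + 2 * t)            ≡⟨ cong (length (filter (Fixed? f) xs) +_) (sym (*-suc 2 t)) ⟩
          length (filter (Fixed? f) xs) + 2 * suc t              ∎)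
        where
        open ≡-Reasoning
        fx∈ : f x ∈ xs
        fx∈ with closed (here refl)
        ... | here fx≡x = contradiction fx≡x fx≢x
        ... | there fx∈ = fx∈
        ys = remove (f x) xs
        fx-unfixed : f (f x) ≢ f x
        fx-unfixed eq = fx≢x (trans (sym eq) (involutive x))
        closedʸ : ∀ {y} → y ∈ ys → f y ∈ ys
        closedʸ y∈ with ∈-filter⁻ (λ y → ¬? (y ≟ᴬ f x)) y∈
        ... | y∈xs , y≢fx with closed (there y∈xs)
        ...   | here fy≡x = contradiction (trans (sym (involutive _)) (cong f fy≡x)) y≢fx
        ...   | there fy∈ = ∈-filter⁺ (λ y → ¬? (y ≟ᴬ f x)) fy∈
                  (λ fy≡fx → All.lookup x∉ y∈xs (sym (trans (sym (involutive _)) (trans (cong f fy≡fx) (involutive x)))))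
        len′ : length ys ≤ N
        len′ = ≤-pred (subst (_≤ suc N) (length-remove u fx∈) (m≤n⇒m≤1+n len))
        t   = proj₁ (go N len′ (Unique.filter⁺ (λ y → ¬? (y ≟ᴬ f x)) u) closedʸ)
        eq  = proj₂ (go N len′ (Unique.filter⁺ (λ y → ¬? (y ≟ᴬ f x)) u) closedʸ)

Adjacent : List ℕ → ℕ → ℕ → Set
Adjacent π j i = ⌈ val π (suc i) /2⌉ ≡ j × ⌈ val π (2 + i) /2⌉ ≡ j × val π (suc i) ≢ val π (2 + i)

Enclosed : ℕ → List ℕ → ℕ → ℕ → Set
Enclosed n π j i = j < ⌈ val π i /2⌉ × (n ≤ 2 + i ⊎ j < ⌈ val π (3 + i) /2⌉)

-- Swapping the values 2j-1 and 2j of π keeps the peak set unless they are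
-- adjacent with a smaller neighbour; Swappable excludes exactly that.
Swappable : ℕ → List ℕ → ℕ → Set
Swappable n π j = 2 * j ≤ n × (∀ i → Adjacent π j i → Enclosed n π j i)

Adjacent? : ∀ π j i → Dec (Adjacent π j i)
Adjacent? π j i =
  (⌈ val π (suc i) /2⌉ ≟ j) ×-dec (⌈ val π (2 + i) /2⌉ ≟ j) ×-dec ¬? (val π (suc i) ≟ val π (2 + i))

Enclosed? : ∀ n π j i → Dec (Enclosed n π j i)
Enclosed? n π j i = (j <? ⌈ val π i /2⌉) ×-dec ((n ≤? 2 + i) ⊎-dec (j <? ⌈ val π (3 + i) /2⌉))

Adjacent⇒< : ∀ π {j i} → Adjacent π j i → i < length π
Adjacent⇒< π {j} {i} (_ , _ , distinct) with i <? length π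
... | yes i< = i<
... | no  i≮ = contradiction (trans (at-beyond π (≮⇒≥ i≮)) (sym (at-beyond π (m≤n⇒m≤1+n (≮⇒≥ i≮))))) distinct

Swappable? : ∀ n π → Decidable (Swappable n π)
Swappable? n π j = (2 * j ≤? n) ×-dec map′ (λ f i adj → f (Adjacent⇒< π adj) adj) (λ f {i} _ → f i)
  (allUpTo? (λ i → Adjacent? π j i →-dec Enclosed? n π j i) (length π))

unswappable-witness : ∀ {n π j} → 2 * j ≤ n → ¬ Swappable n π j → ∃[ i ] Adjacent π j i × ¬ Enclosed n π j i
unswappable-witness {n} {π} {j} 2j≤n ¬sw
  with anyUpTo? (λ i → Adjacent? π j i ×-dec ¬? (Enclosed? n π j i)) (length π)
... | yes (i , _ , witness) = i , witness
... | no  none              = contradiction (2j≤n , enclosed) ¬sw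
  where
  enclosed : ∀ i → Adjacent π j i → Enclosed n π j i
  enclosed i adj with Enclosed? n π j i
  ... | yes encl = encl
  ... | no ¬encl = contradiction (i , Adjacent⇒< π adj , adj , ¬encl) none

greatest : {P : ℕ → Set} → Decidable P → ℕ → Maybe ℕ
greatest P? zero    = nothing
greatest P? (suc m) = if does (P? (suc m)) then just (suc m) else greatest P? m

module _ {P : ℕ → Set} (P? : Decidable P) where

  greatest-just : ∀ {m k} → greatest P? m ≡ just k → 1 ≤ k × P k
  greatest-just {suc m} eq with P? (suc m)
  greatest-just {suc m} refl | yes p = s≤s z≤n , p
  ... | no _ = greatest-just {m} eq

  greatest-nothing⁻ : ∀ {m} → greatest P? m ≡ nothing → ∀ {j} → 1 ≤ j → j ≤ m → ¬ P j
  greatest-nothing⁻ {zero}  _  (s≤s _) () _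
  greatest-nothing⁻ {suc m} eq {j} 1≤j j≤ p with P? (suc m)
  ... | no ¬pm with m≤n⇒m<n∨m≡n j≤
  ... | inj₁ (s≤s j≤m) = greatest-nothing⁻ eq 1≤j j≤m p
  ... | inj₂ refl       = ¬pm p

  greatest-nothing⁺ : ∀ {m} → (∀ {j} → 1 ≤ j → j ≤ m → ¬ P j) → greatest P? m ≡ nothing
  greatest-nothing⁺ {zero}  _    = refl
  greatest-nothing⁺ {suc m} none with P? (suc m)
  ... | yes p = contradiction p (none (s≤s z≤n) ≤-refl)
  ... | no _  = greatest-nothing⁺ (λ 1≤j j≤m → none 1≤j (m≤n⇒m≤1+n j≤m))

greatest-cong : ∀ {P Q : ℕ → Set} (P? : Decidable P) (Q? : Decidable Q) → (∀ j → P j ⇔ Q j)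
              → ∀ m → greatest P? m ≡ greatest Q? m
greatest-cong P? Q? P⇔Q zero    = refl
greatest-cong P? Q? P⇔Q (suc m) with P? (suc m) | Q? (suc m)
... | yes _ | yes _ = refl
... | yes p | no ¬q = contradiction (Equivalence.to (P⇔Q (suc m)) p) ¬q
... | no ¬p | yes q = contradiction (Equivalence.from (P⇔Q (suc m)) q) ¬p
... | no _  | no _  = greatest-cong P? Q? P⇔Q m

module _ {P : ℕ → Set} (P? : Decidable P) (π : List ℕ) where
  private
    g = swapBlocks P?
    val-swap = val-swapBlocks P? π
    ⌈val-swap⌉ = ⌈val-swapBlocks/2⌉ P? π

  Adjacent-swapBlocks : ∀ j i → Adjacent (map g π) j i ⇔ Adjacent π j i
  Adjacent-swapBlocks j i = mk⇔
    (λ (a , b , distinct) → trans (sym (⌈val-swap⌉ _)) a , trans (sym (⌈val-swap⌉ _)) b ,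
       λ eq → distinct (trans (val-swap _) (trans (cong g eq) (sym (val-swap _)))))
    (λ (a , b , distinct) → trans (⌈val-swap⌉ _) a , trans (⌈val-swap⌉ _) b ,
       λ eq → distinct (swapBlocks-injective P? (trans (sym (val-swap _)) (trans eq (val-swap _)))))

  Enclosed-swapBlocks : ∀ n j i → Enclosed n (map g π) j i ⇔ Enclosed n π j i
  Enclosed-swapBlocks n j i = mk⇔
    (λ (l , r) → subst (j <_) (⌈val-swap⌉ i) l , map₂ (subst (j <_) (⌈val-swap⌉ (3 + i))) r)
    (λ (l , r) → subst (j <_) (sym (⌈val-swap⌉ i)) l , map₂ (subst (j <_) (sym (⌈val-swap⌉ (3 + i)))) r)

  Swappable-swapBlocks : ∀ n j → Swappable n (map g π) j ⇔ Swappable n π j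
  Swappable-swapBlocks n j = mk⇔
    (λ (2j≤n , sw) → 2j≤n , λ i adj →
       Equivalence.to (Enclosed-swapBlocks n j i) (sw i (Equivalence.from (Adjacent-swapBlocks j i) adj)))
    (λ (2j≤n , sw) → 2j≤n , λ i adj →
       Equivalence.from (Enclosed-swapBlocks n j i) (sw i (Equivalence.to (Adjacent-swapBlocks j i) adj)))

swapBlock : ℕ → ℕ → ℕ
swapBlock k = swapBlocks (_≟ k)

swapBlock-preserves-< : ∀ {k x y} → ¬ (⌈ x /2⌉ ≡ k × ⌈ y /2⌉ ≡ k × x ≢ y) → x < y ⇔ swapBlock k x < swapBlock k y
swapBlock-preserves-< {k} notPair =
  swapBlocks-preserves-< (_≟ k) (λ x≢y same x∈k → notPair (x∈k , trans (sym same) x∈k , x≢y))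

module _ {n π k} (1≤k : 1 ≤ k) (swappable : Swappable n π k) where
  private
    π′ = map (swapBlock k) π
    v  = val π
    v′ = val π′

    val-swap = val-swapBlocks (_≟ k) π
    ⌈val-swap⌉ = ⌈val-swapBlocks/2⌉ (_≟ k) π

    preserved : ∀ a b → ¬ (⌈ v a /2⌉ ≡ k × ⌈ v b /2⌉ ≡ k × v a ≢ v b) → v a < v b ⇔ v′ a < v′ b
    preserved a b notPair =
      subst₂ (λ x y → v a < v b ⇔ x < y) (sym (val-swap a)) (sym (val-swap b)) (swapBlock-preserves-< notPair)

    blocked : ∀ a b → ⌈ v b /2⌉ < ⌈ v a /2⌉ → ¬ v a < v b × ¬ v′ a < v′ b
    blocked a b lt = lower-block-≮ lt , lower-block-≮ (subst₂ _<_ (sym (⌈val-swap⌉ b)) (sym (⌈val-swap⌉ a)) lt)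

    reversed : ∀ {i} → ¬ Adjacent π k i → ¬ (⌈ v (2 + i) /2⌉ ≡ k × ⌈ v (suc i) /2⌉ ≡ k × v (2 + i) ≢ v (suc i))
    reversed ¬adj (b , a , distinct) = ¬adj (a , b , distinct ∘ sym)

    -- When block k sits at suc q and 2 + q, or at q and suc q, the enclosing
    -- neighbour rules out a peak at suc q before and after the swap.
    sides : ∀ q → suc q < n
          → (v q < v (suc q) × v (2 + q) < v (suc q)) ⇔ (v′ q < v′ (suc q) × v′ (2 + q) < v′ (suc q))
    sides q q< with Adjacent? π k q
    ... | yes adj@(in-k , _) =
      let (¬l , ¬l′) = blocked q (suc q) (subst (_< ⌈ v q /2⌉) (sym in-k) (proj₁ (proj₂ swappable q adj)))
      in mk⇔ (λ (l , _) → contradiction l ¬l) (λ (l , _) → contradiction l ¬l′)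
    sides zero q< | no ¬adj =
      preserved 0 1 (λ (0∈k , _) → m<n⇒n≢0 1≤k (sym 0∈k)) ×-⇔ preserved 2 1 (reversed ¬adj)
    sides (suc i) q< | no ¬adj with Adjacent? π k i | proj₂ swappable i
    ... | no ¬adj′ | _ = preserved (suc i) (2 + i) ¬adj′ ×-⇔ preserved (3 + i) (2 + i) (reversed ¬adj)
    ... | yes adj′@(_ , in-k , _) | enclosed with proj₂ (enclosed adj′)
    ...   | inj₁ n≤ = contradiction q< (≤⇒≯ n≤)
    ...   | inj₂ lt =
      let (¬r , ¬r′) = blocked (3 + i) (2 + i) (subst (_< ⌈ v (3 + i) /2⌉) (sym in-k) lt)
      in mk⇔ (λ (_ , r) → contradiction r ¬r) (λ (_ , r) → contradiction r ¬r′)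

  swapBlock-preserves-peaks : ∀ i → IsPeak n π i ⇔ IsPeak n π′ i
  swapBlock-preserves-peaks zero    = mk⇔ id id
  swapBlock-preserves-peaks (suc q) = mk⇔
    (λ (q< , peak) → q< , Equivalence.to (sides q q<) peak)
    (λ (q< , peak) → q< , Equivalence.from (sides q q<) peak)

applySwap : Maybe ℕ → List ℕ → List ℕ
applySwap nothing  π = π
applySwap (just k) π = map (swapBlock k) π

toggle : ℕ → List ℕ → List ℕ
toggle n π = applySwap (greatest (Swappable? n π) n) π

toggle-involutive : ∀ n π → toggle n (toggle n π) ≡ π
toggle-involutive n π with greatest (Swappable? n π) n in eq
... | nothing rewrite eq = refl
... | just k
  rewrite greatest-cong (Swappable? n (map (swapBlock k) π)) (Swappable? n π) (Swappable-swapBlocks (_≟ k) π n) n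
        | eq = map-involutive (swapBlocks-involutive (_≟ k)) π

toggle-perm : ∀ {n π} → IsPerm n π → IsPerm n (toggle n π)
toggle-perm {n} {π} perm with greatest (Swappable? n π) n in eq
... | nothing = perm
... | just k with greatest-just (Swappable? n π) {n} eq
... | _ , 2k≤n , _ = map-involution-perm (swapBlock k) (swapBlocks-involutive (_≟ k))
  (swapBlocks-range (_≟ k) (λ {x} x∈k _ → ≤-trans (partner≤2*⌈n/2⌉ x) (subst (λ j → 2 * j ≤ n) (sym x∈k) 2k≤n)))
  perm

toggle-peaks : ∀ n π i → IsPeak n π i ⇔ IsPeak n (toggle n π) i
toggle-peaks n π i with greatest (Swappable? n π) n in eq
... | nothing = mk⇔ id id
... | just k with greatest-just (Swappable? n π) {n} eq
... | 1≤k , swappable = swapBlock-preserves-peaks 1≤k swappable i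

toggle-fixed⇔unswappable : ∀ {n π} → IsPerm n π → toggle n π ≡ π ⇔ (∀ {j} → 1 ≤ j → ¬ Swappable n π j)
toggle-fixed⇔unswappable {n} {π} perm = mk⇔ to from
  where
  to : toggle n π ≡ π → ∀ {j} → 1 ≤ j → ¬ Swappable n π j
  to fixed {j} 1≤j swappable with greatest (Swappable? n π) n in eq
  ... | nothing =
    greatest-nothing⁻ (Swappable? n π) {n} eq 1≤j (≤-trans (m≤m+n j (j + 0)) (proj₁ swappable)) swappable
  ... | just k with greatest-just (Swappable? n π) {n} eq
  ... | 1≤k , 2k≤n , _ =
    partner≢ 1≤2k (trans (sym (swapBlocks-swap (_≟ k) (⌈2*n/2⌉≡n k))) (map-fixed fixed 2k∈π))
    where
    1≤2k = ≤-trans 1≤k (m≤m+n k (k + 0))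
    2k∈π = perm-∈⁺ perm 1≤2k 2k≤n
  from : (∀ {j} → 1 ≤ j → ¬ Swappable n π j) → toggle n π ≡ π
  from none rewrite greatest-nothing⁺ (Swappable? n π) {n} (λ 1≤j _ → none 1≤j) = refl

BlockPreserving : ℕ → List ℕ → Set
BlockPreserving n π = ∀ {q} → q ≤ n → ⌈ val π q /2⌉ ≡ ⌈ q /2⌉

BlocksBelow : ℕ → List ℕ → ℕ → Set
BlocksBelow n π j = ∀ {q} → q ≤ n → ⌈ val π q /2⌉ ≤ j ⇔ ⌈ q /2⌉ ≤ j

module _ {n π} (perm : IsPerm n π) where
  private
    v = val π

    ≤n-of-block : ∀ {q j} → ⌈ v q /2⌉ ≡ suc j → q ≤ n
    ≤n-of-block {q} in-j with q ≤? n
    ... | yes q≤n = q≤n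
    ... | no  q≰n = contradiction (trans (sym in-j) (cong ⌈_/2⌉ (perm-val-beyond perm (≰⇒> q≰n)))) λ ()

  blocksBelow-0 : BlocksBelow n π 0
  blocksBelow-0 {zero}  _   = mk⇔ id id
  blocksBelow-0 {suc q} q≤n = mk⇔ (λ le → contradiction (≤-trans (⌈n/2⌉-mono 1≤v) le) λ ()) λ ()
    where 1≤v = proj₁ (perm-val-range perm (s≤s z≤n) q≤n)

  blocksBelow-large : ∀ {j} → n ≤ 2 * j → BlocksBelow n π j
  blocksBelow-large {j} n≤2j {q} q≤n = mk⇔ (λ _ → below q≤n) (λ _ → below (value≤n q q≤n))
    where
    below : ∀ {x} → x ≤ n → ⌈ x /2⌉ ≤ j
    below x≤n = ≤-trans (⌈n/2⌉-mono (≤-trans x≤n n≤2j)) (≤-reflexive (⌈2*n/2⌉≡n j))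
    value≤n : ∀ q → q ≤ n → v q ≤ n
    value≤n zero    _   = z≤n
    value≤n (suc q) q≤n = proj₂ (perm-val-range perm (s≤s z≤n) q≤n)

  -- The values of block suc j sit at suc i and 2 + i; as they are not enclosed,
  -- position i lies in a block ≤ j, which pins suc i and 2 + i to block suc j.
  blocksBelow-step : ∀ {j i} → BlocksBelow n π j → Adjacent π (suc j) i → ¬ Enclosed n π (suc j) i
                   → BlocksBelow n π (suc j)
  blocksBelow-step {j} {i} below (a∈ , b∈ , a≢b) notEnclosed {q} q≤n = mk⇔ values⇒positions positions⇒values
    where
    a≤n = ≤n-of-block a∈
    b≤n = ≤n-of-block b∈

    in-pair : ∀ {r} → r ≤ n → ⌈ v r /2⌉ ≡ suc j → r ≡ suc i ⊎ r ≡ 2 + i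
    in-pair r≤n r∈ with block-pair (trans b∈ (sym a∈)) (a≢b ∘ sym) (trans r∈ (sym a∈))
    ... | inj₁ eq = inj₁ (perm-val-injective perm r≤n a≤n eq)
    ... | inj₂ eq = inj₂ (perm-val-injective perm r≤n b≤n eq)

    j<⌈a⌉ : j < ⌈ suc i /2⌉
    j<⌈a⌉ = ≰⇒> (λ le → 1+n≰n (subst (_≤ j) a∈ (Equivalence.from (below a≤n) le)))

    higher : ∀ {r} → r ≤ n → j < ⌈ r /2⌉ → r ≢ suc i → r ≢ 2 + i → suc j < ⌈ v r /2⌉
    higher r≤n j<r r≢a r≢b =
      ≤∧≢⇒< (≰⇒> (<⇒≱ j<r ∘ Equivalence.to (below r≤n))) (λ eq → [ r≢a , r≢b ]′ (in-pair r≤n (sym eq)))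

    right : n ≤ 2 + i ⊎ suc j < ⌈ v (3 + i) /2⌉
    right with 3 + i ≤? n
    ... | no  ≰  = inj₁ (≤-pred (≰⇒> ≰))
    ... | yes ≤n = inj₂ (higher ≤n (<-≤-trans j<⌈a⌉ (⌈n/2⌉-mono (m≤n+m (suc i) 2)))
                                (m≢1+n+m i ∘ sym ∘ suc-injective) 1+n≢n)

    left-low : ⌈ i /2⌉ ≤ j
    left-low with ⌈ i /2⌉ ≤? j
    ... | yes le = le
    ... | no  ≰  =
      contradiction (higher (≤-trans (n≤1+n i) a≤n) (≰⇒> ≰) (1+n≢n ∘ sym) (m≢1+n+m i) , right) notEnclosed

    ⌈a⌉≡ : ⌈ suc i /2⌉ ≡ suc j
    ⌈a⌉≡ = ≤-antisym (≤-trans (⌈n/2⌉-mono (n≤1+n (suc i))) (s≤s left-low)) j<⌈a⌉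

    ⌈b⌉≡ : ⌈ 2 + i /2⌉ ≡ suc j
    ⌈b⌉≡ = ≤-antisym (s≤s left-low) (≤-trans j<⌈a⌉ (⌈n/2⌉-mono (n≤1+n (suc i))))

    values⇒positions : ⌈ v q /2⌉ ≤ suc j → ⌈ q /2⌉ ≤ suc j
    values⇒positions le with m≤n⇒m<n∨m≡n le
    ... | inj₁ (s≤s lt) = m≤n⇒m≤1+n (Equivalence.to (below q≤n) lt)
    ... | inj₂ eq with in-pair q≤n eq
    ...   | inj₁ refl = ≤-reflexive ⌈a⌉≡
    ...   | inj₂ refl = ≤-reflexive ⌈b⌉≡

    positions⇒values : ⌈ q /2⌉ ≤ suc j → ⌈ v q /2⌉ ≤ suc j
    positions⇒values le with m≤n⇒m<n∨m≡n le
    ... | inj₁ (s≤s lt) = m≤n⇒m≤1+n (Equivalence.from (below q≤n) lt)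
    ... | inj₂ eq with block-pair (trans ⌈b⌉≡ (sym ⌈a⌉≡)) 1+n≢n (trans eq (sym ⌈a⌉≡))
    ...   | inj₁ refl = ≤-reflexive a∈
    ...   | inj₂ refl = ≤-reflexive b∈

  unswappable⇒blockPreserving : (∀ {j} → 1 ≤ j → ¬ Swappable n π j) → BlockPreserving n π
  unswappable⇒blockPreserving unswappable {q} q≤n =
    ≤-antisym (Equivalence.from (below ⌈ q /2⌉ q≤n) ≤-refl) (Equivalence.to (below ⌈ val π q /2⌉ q≤n) ≤-refl)
    where
    below : ∀ j → BlocksBelow n π j
    below zero    = blocksBelow-0
    below (suc j) with 2 * suc j ≤? n
    ... | yes le = let (_ , adj , notEnclosed) = unswappable-witness le (unswappable (s≤s z≤n))
                   in blocksBelow-step (below j) adj notEnclosed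
    ... | no  ≰  = blocksBelow-large (<⇒≤ (≰⇒> ≰))

blockPreserving⇒unswappable : ∀ {n π} → IsPerm n π → BlockPreserving n π → ∀ {j} → 1 ≤ j → ¬ Swappable n π j
blockPreserving⇒unswappable {n} {π} perm preserving {suc t} _ (2j≤n , enclosing) =
  n≮n t (<-trans (n<1+n t) (subst (suc t <_) ⌈v2t/2⌉ (proj₁ (enclosing (2 * t) adjacent))))
  where
  2+2t≤n : 2 + 2 * t ≤ n
  2+2t≤n = subst (_≤ n) (*-suc 2 t) 2j≤n
  1+2t≤n = ≤-trans (n≤1+n _) 2+2t≤n
  ⌈v2t/2⌉ : ⌈ val π (2 * t) /2⌉ ≡ t
  ⌈v2t/2⌉ = trans (preserving (≤-trans (n≤1+n _) 1+2t≤n)) (⌈2*n/2⌉≡n t)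
  adjacent : Adjacent π (suc t) (2 * t)
  adjacent = trans (preserving 1+2t≤n) (cong suc (⌊2*n/2⌋≡n t))
           , trans (preserving 2+2t≤n) (cong suc (⌈2*n/2⌉≡n t))
           , 1+n≢n ∘ sym ∘ perm-val-injective perm 1+2t≤n 2+2t≤n

module _ {n π} (preserving : BlockPreserving n π) where

  peak⇒odd : ∀ {i} → IsPeak n π i → ⌈ suc i /2⌉ ≡ ⌈ i /2⌉
  peak⇒odd {suc k} (k< , _ , right) = ≤-antisym
    (subst₂ _≤_ (preserving k<) (preserving (<⇒≤ k<)) (⌈n/2⌉-mono (<⇒≤ right)))
    (⌈n/2⌉-mono (n≤1+n (suc k)))

  peak⇔descent : ∀ {k} → ⌈ 2 + k /2⌉ ≡ ⌈ suc k /2⌉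
               → IsPeak n π (suc k) ⇔ (suc k < n × val π (2 + k) < val π (suc k))
  peak⇔descent {k} odd = mk⇔ (λ (k< , _ , right) → k< , right) (λ (k< , right) → k< , ascent k< , right)
    where
    ascent : suc k < n → val π k < val π (suc k)
    ascent k< = ⌈n/2⌉-cancel-< (subst₂ _<_ (sym (preserving (≤-trans (n≤1+n k) (<⇒≤ k<))))
                                           (sym (preserving (<⇒≤ k<))) (≤-reflexive odd))

-- A block-preserving permutation is fixed by its peak set: the pair of values
-- in positions 2t+1, 2t+2 is 2t+1, 2t+2 in some order, and 2t+1 is a peak
-- exactly when that order is decreasing.
blockPreserving-unique : ∀ {n π ρ} → IsPerm n π → IsPerm n ρ → BlockPreserving n π → BlockPreserving n ρ
                       → (∀ i → IsPeak n π i ⇔ IsPeak n ρ i) → π ≡ ρ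
blockPreserving-unique {n} {π} {ρ} permπ permρ presπ presρ samePeaks =
  at-ext (trans (perm-length permπ) (sym (perm-length permρ))) (λ i → same-val (suc i))
  where
  module _ {k} (odd : ⌈ 2 + k /2⌉ ≡ ⌈ suc k /2⌉) where
    module _ {σ} (perm : IsPerm n σ) (pres : BlockPreserving n σ) where
      distinct : 2 + k ≤ n → val σ (suc k) ≢ val σ (2 + k)
      distinct 2+k≤n = 1+n≢n ∘ sym ∘ perm-val-injective perm (≤-trans (n≤1+n _) 2+k≤n) 2+k≤n

      ordered : 2 + k ≤ n → (val σ (2 + k) < val σ (suc k) → val σ (suc k) ≡ 2 + k)
                          × (val σ (2 + k) ≮ val σ (suc k) → val σ (suc k) ≡ suc k)
      ordered 2+k≤n = ordered-block odd (pres (≤-trans (n≤1+n _) 2+k≤n)) (trans (pres 2+k≤n) odd) (distinct 2+k≤n)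

      second : 2 + k ≤ n → val σ (2 + k) ≡ partner (val σ (suc k))
      second 2+k≤n = other-of-block (trans (pres 2+k≤n) (trans odd (sym (pres (≤-trans (n≤1+n _) 2+k≤n)))))
                                    (distinct 2+k≤n ∘ sym)

      alone : suc k ≤ n → n < 2 + k → val σ (suc k) ≡ suc k
      alone k≤n n< with same-block (suc k) (val σ (suc k)) (pres k≤n)
      ... | inj₁ eq = eq
      ... | inj₂ eq = contradiction
        (subst (_≤ n) (trans eq (odd⇒partner≡suc odd)) (proj₂ (perm-val-range perm (s≤s z≤n) k≤n))) (<⇒≱ n<)

    descents : suc k < n → val π (2 + k) < val π (suc k) ⇔ val ρ (2 + k) < val ρ (suc k)
    descents k< = mk⇔ (transfer presπ presρ (Equivalence.to (samePeaks (suc k))))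
                      (transfer presρ presπ (Equivalence.from (samePeaks (suc k))))
      where
      transfer : ∀ {σ τ} → BlockPreserving n σ → BlockPreserving n τ → (IsPeak n σ (suc k) → IsPeak n τ (suc k))
               → val σ (2 + k) < val σ (suc k) → val τ (2 + k) < val τ (suc k)
      transfer presσ presτ peak→peak desc =
        proj₂ (Equivalence.to (peak⇔descent presτ odd)
                (peak→peak (Equivalence.from (peak⇔descent presσ odd) (k< , desc))))

    first-equal : 2 + k ≤ n → val π (suc k) ≡ val ρ (suc k)
    first-equal 2+k≤n with val π (2 + k) <? val π (suc k)
    ... | yes desc = trans (proj₁ (ordered permπ presπ 2+k≤n) desc)
                           (sym (proj₁ (ordered permρ presρ 2+k≤n) (Equivalence.to (descents 2+k≤n) desc)))
    ... | no  asc  = trans (proj₂ (ordered permπ presπ 2+k≤n) asc)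
                           (sym (proj₂ (ordered permρ presρ 2+k≤n) (asc ∘ Equivalence.from (descents 2+k≤n))))

    second-equal : 2 + k ≤ n → val π (2 + k) ≡ val ρ (2 + k)
    second-equal 2+k≤n = trans (second permπ presπ 2+k≤n)
                        (trans (cong partner (first-equal 2+k≤n)) (sym (second permρ presρ 2+k≤n)))

  same-val : ∀ q → val π q ≡ val ρ q
  same-val zero = refl
  same-val (suc q) with suc q ≤? n
  ... | no  ≰   = trans (perm-val-beyond permπ (≰⇒> ≰)) (sym (perm-val-beyond permρ (≰⇒> ≰)))
  ... | yes q≤n with block-start q
  ... | k , odd , pos with 2 + k ≤? n | pos
  ...   | yes 2+k≤n | inj₁ refl = first-equal odd 2+k≤n
  ...   | yes 2+k≤n | inj₂ refl = second-equal odd 2+k≤n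
  ...   | no  ≰     | inj₁ refl =
    trans (alone odd permπ presπ q≤n (≰⇒> ≰)) (sym (alone odd permρ presρ q≤n (≰⇒> ≰)))
  ...   | no  ≰     | inj₂ refl = contradiction q≤n ≰

PeakBlock : List ℕ → ℕ → Set
PeakBlock S j = Any (λ i → ⌈ i /2⌉ ≡ j) S

PeakBlock? : ∀ S → Decidable (PeakBlock S)
PeakBlock? S j = any? (λ i → ⌈ i /2⌉ ≟ j) S

canonical : List ℕ → ℕ → List ℕ
canonical S n = map (swapBlocks (PeakBlock? S)) (oneTo n)

module _ {S n} (odd : ∀ {i} → i ∈ S → ⌈ suc i /2⌉ ≡ ⌈ i /2⌉) (bounded : ∀ {i} → i ∈ S → i < n) where
  private
    c = swapBlocks (PeakBlock? S)
    γ = canonical S n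

    val-γ : ∀ {q} → q ≤ n → val γ q ≡ c q
    val-γ {q} q≤n = trans (val-map c (oneTo n) q (swapBlocks-0 (PeakBlock? S))) (cong c (val-oneTo q≤n))

    partner-bounded : ∀ {x} → PeakBlock S ⌈ x /2⌉ → x ≤ n → partner x ≤ n
    partner-bounded {x} inBlock _ with find inBlock
    ... | i , i∈ , i∼x with same-block i (partner x) (trans (⌈partner/2⌉ x) (sym i∼x))
    ...   | inj₁ eq = subst (_≤ n) (sym eq) (<⇒≤ (bounded i∈))
    ...   | inj₂ eq = subst (_≤ n) (sym (trans eq (odd⇒partner≡suc (odd i∈)))) (bounded i∈)

  canonical-perm : IsPerm n γ
  canonical-perm = map-involution-perm c (swapBlocks-involutive (PeakBlock? S))
                     (swapBlocks-range (PeakBlock? S) partner-bounded) ↭-refl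

  canonical-preserving : BlockPreserving n γ
  canonical-preserving {q} q≤n = trans (cong ⌈_/2⌉ (val-γ q≤n)) (⌈swapBlocks/2⌉ (PeakBlock? S) q)

  canonical-peaks : ∀ i → i ∈ S ⇔ IsPeak n γ i
  canonical-peaks _ = mk⇔ to from
    where
    to : ∀ {i} → i ∈ S → IsPeak n γ i
    to {zero}  i∈ = contradiction (odd i∈) λ ()
    to {suc k} i∈ = Equivalence.from (peak⇔descent canonical-preserving odd-k) (k< , descent)
      where
      odd-k = odd i∈
      k< = bounded i∈
      swapped : c (suc k) ≡ 2 + k
      swapped = trans (swapBlocks-swap (PeakBlock? S) (lose i∈ refl)) (odd⇒partner≡suc odd-k)
      swapped′ : c (2 + k) ≡ suc k
      swapped′ = trans (swapBlocks-swap (PeakBlock? S) (lose i∈ (sym odd-k)))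
                       (trans (cong partner (sym (odd⇒partner≡suc odd-k))) (partner-involutive (suc k)))
      descent : val γ (2 + k) < val γ (suc k)
      descent = subst₂ _<_ (sym (trans (val-γ k<) swapped′)) (sym (trans (val-γ (<⇒≤ k<)) swapped)) ≤-refl
    from : ∀ {i} → IsPeak n γ i → i ∈ S
    from {suc k} peak with peak⇒odd canonical-preserving peak
    ... | odd-k with Equivalence.to (peak⇔descent canonical-preserving odd-k) peak | PeakBlock? S ⌈ suc k /2⌉
    ...   | _ , _ | yes inBlock =
      let (i′ , i′∈ , i′∼) = find inBlock in subst (_∈ S) (odd-same-block odd-k (odd i′∈) i′∼) i′∈
    ...   | k< , descent | no  notBlock = contradiction descent (<-asym (subst₂ _<_
              (sym (trans (val-γ (<⇒≤ k<)) (swapBlocks-keep (PeakBlock? S) notBlock)))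
              (sym (trans (val-γ k<) (swapBlocks-keep (PeakBlock? S) (notBlock ∘ subst (PeakBlock S) odd-k))))
              ≤-refl))

toggle-fixed⇔blockPreserving : ∀ {n π} → IsPerm n π → toggle n π ≡ π ⇔ BlockPreserving n π
toggle-fixed⇔blockPreserving perm = mk⇔
  (unswappable⇒blockPreserving perm ∘ Equivalence.to (toggle-fixed⇔unswappable perm))
  (Equivalence.from (toggle-fixed⇔unswappable perm) ∘ blockPreserving⇒unswappable perm)

toggle-InPhat : ∀ {S n π} → InPhat S n π → InPhat S n (toggle n π)
toggle-InPhat {n = n} {π} (perm , peaks) = toggle-perm perm , λ i → ⇔.trans (peaks i) (toggle-peaks n π i)

peak<n : ∀ {n π i} → IsPeak n π i → i < n
peak<n {i = suc k} (k< , _) = k<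

_≟ₗ_ : DecidableEquality (List ℕ)
_≟ₗ_ = ≡-dec _≟_

fixedPoints : ℕ → List (List ℕ) → List (List ℕ)
fixedPoints n = filter (Fixed? _≟ₗ_ (toggle n))

module _ {S n L} (unique : Unique L) (members : ∀ π → π ∈ L ⇔ InPhat S n π) where

  fixedPoints-parity : ∃[ t ] length L ≡ length (fixedPoints n L) + 2 * t
  fixedPoints-parity = involution-parity _≟ₗ_ (toggle n) (toggle-involutive n) unique
    (λ π∈ → Equivalence.from (members _) (toggle-InPhat (Equivalence.to (members _) π∈)))

  fixedPoints-even : ∀ {i} → i ∈ S → 2 ∣ i → length (fixedPoints n L) ≡ 0
  fixedPoints-even {i} i∈ 2∣i = cong length (filter-none _ (All.tabulate λ {π} π∈ fixed →
    let (perm , peaks) = Equivalence.to (members π) π∈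
        preserving     = Equivalence.to (toggle-fixed⇔blockPreserving perm) fixed
    in Equivalence.from (2∤n⇔⌈1+n/2⌉≡⌈n/2⌉ i) (peak⇒odd preserving (Equivalence.to (peaks i) i∈)) 2∣i))

  fixedPoints-odd : ∀ {π₀} → InPhat S n π₀ → (∀ {i} → i ∈ S → 2 ∤ i) → length (fixedPoints n L) ≡ 1
  fixedPoints-odd (_ , peaks₀) allOdd = length≡1 _≟ₗ_ (Unique.filter⁺ _ unique) γ∈ only
    where
    odd : ∀ {i} → i ∈ S → ⌈ suc i /2⌉ ≡ ⌈ i /2⌉
    odd i∈ = Equivalence.to (2∤n⇔⌈1+n/2⌉≡⌈n/2⌉ _) (allOdd i∈)
    bounded : ∀ {i} → i ∈ S → i < n
    bounded i∈ = peak<n (Equivalence.to (peaks₀ _) i∈)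
    γ-perm = canonical-perm odd bounded
    γ∈ : canonical S n ∈ fixedPoints n L
    γ∈ = ∈-filter⁺ _ (Equivalence.from (members _) (γ-perm , canonical-peaks odd bounded))
                     (Equivalence.from (toggle-fixed⇔blockPreserving γ-perm) (canonical-preserving odd bounded))
    only : ∀ {π} → π ∈ fixedPoints n L → π ≡ canonical S n
    only {π} π∈ with ∈-filter⁻ _ π∈
    ... | π∈L , fixed =
      let (perm , peaks) = Equivalence.to (members π) π∈L
      in blockPreserving-unique perm γ-perm (Equivalence.to (toggle-fixed⇔blockPreserving perm) fixed)
           (canonical-preserving odd bounded) (λ i → ⇔.trans (⇔.sym (peaks i)) (canonical-peaks odd bounded i))

theorem4p17 : (S : List ℕ) (n : ℕ)
    → Σ (List ℕ) (λ π → InPhat S n π)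
    → (L : List (List ℕ)) → Unique L → (∀ π → (π ∈ L) ⇔ InPhat S n π)
    → (2 ∣ length L) ⇔ (∃ λ i → i ∈ S × 2 ∣ i)
theorem4p17 S n (π₀ , π₀∈) L unique members = mk⇔ to from
  where
  t   = proj₁ (fixedPoints-parity unique members)
  len = proj₂ (fixedPoints-parity unique members)
  from : (∃ λ i → i ∈ S × 2 ∣ i) → 2 ∣ length L
  from (i , i∈ , 2∣i) =
    divides t (trans len (trans (cong (_+ 2 * t) (fixedPoints-even unique members i∈ 2∣i)) (*-comm 2 t)))
  to : 2 ∣ length L → ∃ λ i → i ∈ S × 2 ∣ i
  to 2∣L with any? (2 ∣?_) S
  ... | yes someEven = find someEven
  ... | no  noneEven = contradiction
    (subst (2 ∣_) (trans len (cong (_+ 2 * t) (fixedPoints-odd unique members π₀∈ (λ i∈ → noneEven ∘ lose i∈)))) 2∣L)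
    (2∤1+2*n t)
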